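{- For every integer $k\ge2$, the formal power series $$G_k(x,p,q):=\sum_{n\ge1}x^n\sum_{w\in\mathcal F_{n,k}}p^{\mathrm{edg}(G(w))}q^{\mathrm{ver}(G(w))}$$ is equal to $$\frac{p^2q^3\left((p^2q+p^5q^3)x-(p^7q^4-p^8q^5)x^2-p^{5k}q^{3k}x^k-p^{5k+3}q^{3k+2}x^{k+1}\right)}{1-(p^3q^2+p^5q^3)x+(p^8q^5-p^9q^6)x^2+p^{5k+4}q^{3k+3}x^{k+1}}.$$
   Context: For integers $k\ge 2$, $n\ge1$, $\mathcal F_{n,k}$ is the set of binary words $w=w_1\cdots w_n$ with no $k$ consecutive $1$'s. $P(w)$ is the bargraph polyomino formed by the unit squares $[i-1,i]\times[j-1,j]$, $1\le i\le n$, $1\le j\le w_i+1$. The $k$-bonacci graph $G(w)$ is the graph whose vertices are the corners of the cells of $P(w)$ and whose edges are the cell sides (unit segments that are a side of at least one cell). $\mathrm{ver}(G)$ and $\mathrm{edg}(G)$ denote the numbers of vertices and edges of $G$. -}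

module Defs where

open import Data.Bool using (Bool; true; false; _∧_; _∨_; if_then_else_)
open import Data.Nat as ℕ using (ℕ; zero; suc; _≤ᵇ_; _≡ᵇ_)
open import Data.List using (List; []; _∷_; length; map; upTo; concatMap; filter)
open import Data.Nat.ListAction using (sum)
open import Data.Integer as ℤ using (ℤ; +_; _^_)

-- Binary words of length n are lists of Booleans (true = 1, false = 0).

words : ℕ → List (List Bool)
words zero    = [] ∷ []
words (suc n) = concatMap (λ w → (false ∷ w) ∷ (true ∷ w) ∷ []) (words n)

startsWithOnes : ℕ → List Bool → Bool
startsWithOnes zero    _          = true
startsWithOnes (suc k) []         = false
startsWithOnes (suc k) (b ∷ w)    = b ∧ startsWithOnes k w

hasRun : ℕ → List Bool → Bool
hasRun k []       = startsWithOnes k []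
hasRun k (b ∷ w)  = startsWithOnes k (b ∷ w) ∨ hasRun k w

notB : Bool → Bool
notB true  = false
notB false = true

F : ℕ → ℕ → List (List Bool)
F n k = filter (λ w → Data.Bool._≟_ (hasRun k w) false) (words n)

-- height of column i (1-indexed) of P(w): w_i + 1; 0 outside 1..n
height : List Bool → ℕ → ℕ
height w       zero          = 0
height []      (suc i)       = 0
height (b ∷ w) (suc zero)    = if b then 2 else 1
height (b ∷ w) (suc (suc i)) = height w (suc i)

-- the unit square [i-1,i]×[j-1,j] is a cell of P(w)
cell : List Bool → ℕ → ℕ → Bool
cell w i j = (1 ≤ᵇ j) ∧ (j ≤ᵇ height w i)

-- the lattice point (a,b) is a corner of some cell
isVertex : List Bool → ℕ → ℕ → Bool
isVertex w a b = cell w a b ∨ cell w (suc a) b ∨ cell w a (suc b) ∨ cell w (suc a) (suc b)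

isHEdge : List Bool → ℕ → ℕ → Bool
isHEdge w a b = cell w (suc a) b ∨ cell w (suc a) (suc b)

isVEdge : List Bool → ℕ → ℕ → Bool
isVEdge w a b = cell w a (suc b) ∨ cell w (suc a) (suc b)

ind : Bool → ℕ
ind true  = 1
ind false = 0

-- count lattice points / segments with 0 ≤ a ≤ n+1, 0 ≤ b ≤ 3; all cells of P(w)
-- lie in [0,n]×[0,2], so this box contains every vertex and edge of G(w).
countBox : ℕ → (ℕ → ℕ → Bool) → ℕ
countBox n P = sum (map (λ a → sum (map (λ b → ind (P a b)) (upTo 4))) (upTo (suc (suc n))))

ver : List Bool → ℕ
ver w = countBox (length w) (isVertex w)

edg : List Bool → ℕ
edg w = countBox (length w) (isHEdge w) ℕ.+ countBox (length w) (isVEdge w)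

-- coefficient of x^n in G_k(x,p,q), evaluated at integers p, q (zero for n = 0)
g : ℕ → ℤ → ℤ → ℕ → ℤ
g k p q zero    = + 0
g k p q (suc n) = Data.List.foldr ℤ._+_ (+ 0)
  (map (λ w → (p ^ edg w) ℤ.* (q ^ ver w)) (F (suc n) k))

at : ℕ → ℤ → ℕ → ℤ
at m c j = if j ≡ᵇ m then c else + 0

numer : ℕ → ℤ → ℤ → ℕ → ℤ
numer k p q j = (p ^ 2) ℤ.* (q ^ 3) ℤ.*
  ( at 1 ((p ^ 2) ℤ.* q ℤ.+ (p ^ 5) ℤ.* (q ^ 3)) j
  ℤ.- at 2 ((p ^ 7) ℤ.* (q ^ 4) ℤ.- (p ^ 8) ℤ.* (q ^ 5)) j
  ℤ.- at k ((p ^ (5 ℕ.* k)) ℤ.* (q ^ (3 ℕ.* k))) j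
  ℤ.- at (suc k) ((p ^ (5 ℕ.* k ℕ.+ 3)) ℤ.* (q ^ (3 ℕ.* k ℕ.+ 2))) j )

denom : ℕ → ℤ → ℤ → ℕ → ℤ
denom k p q j =
    at 0 (+ 1) j
  ℤ.- at 1 ((p ^ 3) ℤ.* (q ^ 2) ℤ.+ (p ^ 5) ℤ.* (q ^ 3)) j
  ℤ.+ at 2 ((p ^ 8) ℤ.* (q ^ 5) ℤ.- (p ^ 9) ℤ.* (q ^ 6)) j
  ℤ.+ at (suc k) ((p ^ (5 ℕ.* k ℕ.+ 4)) ℤ.* (q ^ (3 ℕ.* k ℕ.+ 3))) j

conv : (ℕ → ℤ) → (ℕ → ℤ) → ℕ → ℤ
conv a b n = Data.List.foldr ℤ._+_ (+ 0) (map (λ j → a j ℤ.* b (n ℕ.∸ j)) (upTo (suc n)))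

-- Prepending a letter to a word w changes edg and ver by amounts depending only on that letter
-- and on the first letter of w, so the weight p^edg q^ver is multiplicative along the word.
-- Splitting the words avoiding 1^k by their first letter gives a transfer system: words starting
-- with 0 come from all shorter words; words starting with 1 come from shorter words starting with
-- 0 or 1, except that the new 1 must not complete a run 1^k, which excludes the shorter words
-- beginning with 1^(k-1); and such a word is 1^(k-1) followed by nothing or by a word starting
-- with 0.
-- Eliminating the three auxiliary sequences leaves a linear recurrence for the coefficients g_n,
-- which says exactly that the denominator times the series is the numerator.
module Submission where

open import Defs
open import Data.Bool using (Bool; true; false; if_then_else_; _∨_)
open import Data.List using (List; []; _∷_; _++_; length; map; foldr; applyUpTo; upTo; replicate; concatMap; filter)
open import Data.List.Properties using (map-applyUpTo)
open import Data.Nat using (ℕ; zero; suc; _∸_; _<_; _≤_; s≤s; z≤n)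
import Data.Nat as ℕ
import Data.Nat.Properties as ℕₚ
open import Relation.Binary.PropositionalEquality
open import Relation.Nullary using (yes; no)
open import Data.Product using (_,_)

module Geometry where
  open import Data.Nat using (_+_)
  open import Data.Nat.ListAction using (sum)
  open import Data.Nat.Tactic.RingSolver using (solve-∀)
  open import Algebra.Properties.CommutativeSemigroup ℕₚ.+-commutativeSemigroup
    using (interchange; xy∙z≈xz∙y)

  column : (ℕ → ℕ → Bool) → ℕ → ℕ
  column P a = sum (map (λ b → ind (P a b)) (upTo 4))

  leadingColumns : (ℕ → ℕ → Bool) → ℕ
  leadingColumns P = column P 0 + column P 1

  sum-applyUpTo-cong : ∀ {f h : ℕ → ℕ} → (∀ i → f i ≡ h i) → ∀ m →
    sum (applyUpTo f m) ≡ sum (applyUpTo h m)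
  sum-applyUpTo-cong f≗h zero    = refl
  sum-applyUpTo-cong f≗h (suc m) = cong₂ _+_ (f≗h 0) (sum-applyUpTo-cong (λ i → f≗h (suc i)) m)

  countBox-columns : ∀ n P → countBox n P ≡ sum (applyUpTo (column P) (suc (suc n)))
  countBox-columns n P = cong sum (map-applyUpTo (λ a → a) (column P) (suc (suc n)))

  -- Beyond its first column, P (b ∷ w) is P w shifted one column to the right; for the
  -- cell-based predicates of Defs this holds by computation.
  countBox-∷ : ∀ (P : List Bool → ℕ → ℕ → Bool) b w →
    (∀ a → column (P (b ∷ w)) (2 + a) ≡ column (P w) (1 + a)) →
    countBox (length (b ∷ w)) (P (b ∷ w)) + column (P w) 0
      ≡ leadingColumns (P (b ∷ w)) + countBox (length w) (P w)
  countBox-∷ P b w shift = begin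
    countBox (suc n) Q + column R 0
      ≡⟨ cong (_+ column R 0) (countBox-columns (suc n) Q) ⟩
    (column Q 0 + (column Q 1 + rest Q (λ a → 2 + a))) + column R 0
      ≡⟨ cong (λ r → (column Q 0 + (column Q 1 + r)) + column R 0)
              (sum-applyUpTo-cong shift (suc n)) ⟩
    (column Q 0 + (column Q 1 + rest R suc)) + column R 0
      ≡⟨ regroup (column Q 0) (column Q 1) (rest R suc) (column R 0) ⟩
    leadingColumns Q + (column R 0 + rest R suc)
      ≡˘⟨ cong (leadingColumns Q +_) (countBox-columns n R) ⟩
    leadingColumns Q + countBox n R ∎
    where
    open ≡-Reasoning
    n = length w
    Q = P (b ∷ w)
    R = P w
    rest : (ℕ → ℕ → Bool) → (ℕ → ℕ) → ℕ
    rest S f = sum (applyUpTo (λ a → column S (f a)) (suc n))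
    regroup : ∀ a b c d → (a + (b + c)) + d ≡ (a + b) + (d + c)
    regroup = solve-∀

  cancel-shift : ∀ {x y d₀} d → x + d₀ ≡ (d + d₀) + y → x ≡ d + y
  cancel-shift {x} {y} {d₀} d eq = ℕₚ.+-cancelʳ-≡ d₀ x (d + y) (trans eq (xy∙z≈xz∙y d d₀ y))

  Δver : Bool → List Bool → ℕ
  Δver false []          = 4
  Δver false (_ ∷ _)     = 2
  Δver true  []          = 6
  Δver true  (false ∷ _) = 4
  Δver true  (true ∷ _)  = 3

  Δedg : Bool → List Bool → ℕ
  Δedg false []          = 4
  Δedg false (_ ∷ _)     = 3
  Δedg true  []          = 7
  Δedg true  (false ∷ _) = 6
  Δedg true  (true ∷ _)  = 5

  ver-∷ : ∀ b w → ver (b ∷ w) ≡ Δver b w + ver w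
  ver-∷ false []          = refl
  ver-∷ true  []          = refl
  ver-∷ false (false ∷ w) = cancel-shift 2 (countBox-∷ isVertex false (false ∷ w) λ _ → refl)
  ver-∷ false (true ∷ w)  = cancel-shift 2 (countBox-∷ isVertex false (true ∷ w) λ _ → refl)
  ver-∷ true  (false ∷ w) = cancel-shift 4 (countBox-∷ isVertex true (false ∷ w) λ _ → refl)
  ver-∷ true  (true ∷ w)  = cancel-shift 3 (countBox-∷ isVertex true (true ∷ w) λ _ → refl)

  edgBoxes-∷ : ∀ b w →
    edg (b ∷ w) + (column (isHEdge w) 0 + column (isVEdge w) 0)
      ≡ (leadingColumns (isHEdge (b ∷ w)) + leadingColumns (isVEdge (b ∷ w))) + edg w
  edgBoxes-∷ b w =
    trans (interchange (box isHEdge (b ∷ w)) (box isVEdge (b ∷ w)) (first isHEdge w) (first isVEdge w))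
    (trans (cong₂ _+_ (countBox-∷ isHEdge b w λ _ → refl) (countBox-∷ isVEdge b w λ _ → refl))
           (interchange (leading isHEdge) (box isHEdge w) (leading isVEdge) (box isVEdge w)))
    where
    box first : (List Bool → ℕ → ℕ → Bool) → List Bool → ℕ
    box P u = countBox (length u) (P u)
    first P u = column (P u) 0
    leading : (List Bool → ℕ → ℕ → Bool) → ℕ
    leading P = leadingColumns (P (b ∷ w))

  edg-∷ : ∀ b w → edg (b ∷ w) ≡ Δedg b w + edg w
  edg-∷ false []          = refl
  edg-∷ true  []          = refl
  edg-∷ false (false ∷ w) = cancel-shift 3 (edgBoxes-∷ false (false ∷ w))
  edg-∷ false (true ∷ w)  = cancel-shift 3 (edgBoxes-∷ false (true ∷ w))
  edg-∷ true  (false ∷ w) = cancel-shift 6 (edgBoxes-∷ true (false ∷ w))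
  edg-∷ true  (true ∷ w)  = cancel-shift 5 (edgBoxes-∷ true (true ∷ w))

open Geometry using (Δver; Δedg; ver-∷; edg-∷)

open import Data.Integer using (ℤ; +_; _+_; _*_; _-_; -_; _^_)
open import Data.Integer.Properties
  using ( *-comm; +-assoc; +-identityˡ; +-identityʳ; +-inverseʳ; *-identityˡ; *-identityʳ; *-zeroʳ; *-assoc
        ; *-distribˡ-+; *-distribʳ-+; neg-distrib-+; neg-distribˡ-*; ^-distribˡ-+-*; ^-*-assoc
        ; +-*-ring; +-commutativeSemigroup; *-commutativeSemigroup )
open import Data.Integer.Tactic.RingSolver using (solve-∀; solve)
open import Algebra.Properties.Ring +-*-ring using (x[y-z]≈xy-xz; [y-z]x≈yx-zx)
open import Algebra.Properties.CommutativeSemigroup +-commutativeSemigroup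
  using () renaming (interchange to +-interchange)
open import Algebra.Properties.CommutativeSemigroup *-commutativeSemigroup
  using () renaming (interchange to *-interchange; x∙yz≈y∙xz to *-left-comm; xy∙z≈y∙xz to *-assoc-comm)

sumWords : ℕ → (List Bool → ℤ) → ℤ
sumWords zero    φ = φ []
sumWords (suc m) φ = sumWords m (λ w → φ (false ∷ w) + φ (true ∷ w))

sumWords-cong : ∀ m {φ ψ : List Bool → ℤ} → (∀ w → φ w ≡ ψ w) → sumWords m φ ≡ sumWords m ψ
sumWords-cong zero    φ≗ψ = φ≗ψ []
sumWords-cong (suc m) φ≗ψ = sumWords-cong m λ w → cong₂ _+_ (φ≗ψ (false ∷ w)) (φ≗ψ (true ∷ w))

sumWords-+ : ∀ m (φ ψ : List Bool → ℤ) → sumWords m (λ w → φ w + ψ w) ≡ sumWords m φ + sumWords m ψ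
sumWords-+ zero    φ ψ = refl
sumWords-+ (suc m) φ ψ =
  trans (sumWords-cong m λ w → +-interchange (φ (false ∷ w)) (ψ (false ∷ w)) (φ (true ∷ w)) (ψ (true ∷ w)))
        (sumWords-+ m _ _)

sumWords-* : ∀ m c (φ : List Bool → ℤ) → sumWords m (λ w → c * φ w) ≡ c * sumWords m φ
sumWords-* zero    c φ = refl
sumWords-* (suc m) c φ =
  trans (sumWords-cong m λ w → sym (*-distribˡ-+ c (φ (false ∷ w)) (φ (true ∷ w)))) (sumWords-* m c _)

sumWords-neg : ∀ m (φ : List Bool → ℤ) → sumWords m (λ w → - φ w) ≡ - sumWords m φ
sumWords-neg zero    φ = refl
sumWords-neg (suc m) φ =
  trans (sumWords-cong m λ w → sym (neg-distrib-+ (φ (false ∷ w)) (φ (true ∷ w)))) (sumWords-neg m _)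

sumWords-words : ∀ m (φ : List Bool → ℤ) → foldr _+_ (+ 0) (map φ (words m)) ≡ sumWords m φ
sumWords-words zero    φ = +-identityʳ (φ [])
sumWords-words (suc m) φ = trans (both-letters (words m)) (sumWords-words m _)
  where
  both-letters : ∀ ws →
    foldr _+_ (+ 0) (map φ (concatMap (λ w → (false ∷ w) ∷ (true ∷ w) ∷ []) ws))
      ≡ foldr _+_ (+ 0) (map (λ w → φ (false ∷ w) + φ (true ∷ w)) ws)
  both-letters []       = refl
  both-letters (w ∷ ws) =
    trans (sym (+-assoc (φ (false ∷ w)) (φ (true ∷ w)) _))
          (cong (_+_ (φ (false ∷ w) + φ (true ∷ w))) (both-letters ws))

sum-filter-avoiding : ∀ k (φ : List Bool → ℤ) ws →
  foldr _+_ (+ 0) (map φ (filter (λ w → Data.Bool._≟_ (hasRun k w) false) ws))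
    ≡ foldr _+_ (+ 0) (map (λ w → if hasRun k w then + 0 else φ w) ws)
sum-filter-avoiding k φ []       = refl
sum-filter-avoiding k φ (w ∷ ws) with hasRun k w
... | true  = trans (sum-filter-avoiding k φ ws) (sym (+-identityˡ _))
... | false = cong (_+_ (φ w)) (sum-filter-avoiding k φ ws)

sumWords-startsWithOnes : ∀ r m (φ : List Bool → ℤ) →
  sumWords (r ℕ.+ m) (λ w → if startsWithOnes r w then φ w else + 0)
    ≡ sumWords m (λ w → φ (replicate r true ++ w))
sumWords-startsWithOnes zero    m φ = refl
sumWords-startsWithOnes (suc r) m φ =
  trans (sumWords-cong (r ℕ.+ m) λ w → +-identityˡ _) (sumWords-startsWithOnes r m (λ w → φ (true ∷ w)))

sumWords-startsWithOnes-short : ∀ m r (φ : List Bool → ℤ) → m < r →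
  sumWords m (λ w → if startsWithOnes r w then φ w else + 0) ≡ + 0
sumWords-startsWithOnes-short zero    (suc r) φ _         = refl
sumWords-startsWithOnes-short (suc m) (suc r) φ (s≤s m<r) =
  trans (sumWords-cong m λ w → +-identityˡ _) (sumWords-startsWithOnes-short m r (λ w → φ (true ∷ w)) m<r)

startsWithOnes-replicate-∷ : ∀ i w → startsWithOnes (suc i) (replicate i true ++ true ∷ w) ≡ true
startsWithOnes-replicate-∷ zero    w = refl
startsWithOnes-replicate-∷ (suc i) w = startsWithOnes-replicate-∷ i w

startsWithOnes-replicate-++ : ∀ r i x → i ≤ r → (∀ s → startsWithOnes (suc s) x ≡ false) →
  startsWithOnes (suc r) (replicate i true ++ x) ≡ false
startsWithOnes-replicate-++ r       zero    x _         x≢1 = x≢1 r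
startsWithOnes-replicate-++ (suc r) (suc i) x (s≤s i≤r) x≢1 = startsWithOnes-replicate-++ r i x i≤r x≢1

hasRun-replicate-++ : ∀ r i x → i ≤ r → (∀ s → startsWithOnes (suc s) x ≡ false) →
  hasRun (suc r) (replicate i true ++ x) ≡ hasRun (suc r) x
hasRun-replicate-++ r zero    x _   _   = refl
hasRun-replicate-++ r (suc i) x i<r x≢1 =
  cong₂ _∨_ (startsWithOnes-replicate-++ r (suc i) x i<r x≢1)
            (hasRun-replicate-++ r i x (ℕₚ.<⇒≤ i<r) x≢1)

σ : (ℕ → ℤ) → ℕ → ℤ
σ f m = foldr _+_ (+ 0) (applyUpTo f m)

conv-σ : ∀ f b n → conv f b n ≡ σ (λ i → f i * b (n ∸ i)) (suc n)
conv-σ f b n = cong (foldr _+_ (+ 0)) (map-applyUpTo (λ i → i) (λ i → f i * b (n ∸ i)) (suc n))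

σ-cong : ∀ {f h : ℕ → ℤ} → (∀ i → f i ≡ h i) → ∀ m → σ f m ≡ σ h m
σ-cong f≗h zero    = refl
σ-cong f≗h (suc m) = cong₂ _+_ (f≗h 0) (σ-cong (λ i → f≗h (suc i)) m)

σ-+ : ∀ (f h : ℕ → ℤ) m → σ (λ i → f i + h i) m ≡ σ f m + σ h m
σ-+ f h zero    = refl
σ-+ f h (suc m) =
  trans (cong (_+_ (f 0 + h 0)) (σ-+ (λ i → f (suc i)) (λ i → h (suc i)) m))
        (+-interchange (f 0) (h 0) _ _)

σ-neg : ∀ (f : ℕ → ℤ) m → σ (λ i → - f i) m ≡ - σ f m
σ-neg f zero    = refl
σ-neg f (suc m) = trans (cong (_+_ (- f 0)) (σ-neg (λ i → f (suc i)) m)) (sym (neg-distrib-+ (f 0) _))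

σ-zero : ∀ m → σ (λ _ → + 0) m ≡ + 0
σ-zero zero    = refl
σ-zero (suc m) = trans (+-identityˡ _) (σ-zero m)

σ-at-< : ∀ N m c (h : ℕ → ℤ) → m < N → σ (λ i → at m c i * h i) N ≡ c * h m
σ-at-< (suc N) zero    c h _         = trans (cong (_+_ (c * h 0)) (σ-zero N)) (+-identityʳ _)
σ-at-< (suc N) (suc m) c h (s≤s m<N) = trans (+-identityˡ _) (σ-at-< N m c (λ i → h (suc i)) m<N)

σ-at-≥ : ∀ N m c (h : ℕ → ℤ) → N ≤ m → σ (λ i → at m c i * h i) N ≡ + 0
σ-at-≥ zero    m       c h _         = refl
σ-at-≥ (suc N) (suc m) c h (s≤s N≤m) = trans (+-identityˡ _) (σ-at-≥ N m c (λ i → h (suc i)) N≤m)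

conv-+ : ∀ (f h b : ℕ → ℤ) n → conv (λ i → f i + h i) b n ≡ conv f b n + conv h b n
conv-+ f h b n = begin
  conv (λ i → f i + h i) b n
    ≡⟨ conv-σ (λ i → f i + h i) b n ⟩
  σ (λ i → (f i + h i) * b (n ∸ i)) (suc n)
    ≡⟨ σ-cong (λ i → *-distribʳ-+ (b (n ∸ i)) (f i) (h i)) (suc n) ⟩
  σ (λ i → f i * b (n ∸ i) + h i * b (n ∸ i)) (suc n)
    ≡⟨ σ-+ (λ i → f i * b (n ∸ i)) (λ i → h i * b (n ∸ i)) (suc n) ⟩
  σ (λ i → f i * b (n ∸ i)) (suc n) + σ (λ i → h i * b (n ∸ i)) (suc n)
    ≡˘⟨ cong₂ _+_ (conv-σ f b n) (conv-σ h b n) ⟩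
  conv f b n + conv h b n ∎
  where open ≡-Reasoning

conv-neg : ∀ (f b : ℕ → ℤ) n → conv (λ i → - f i) b n ≡ - conv f b n
conv-neg f b n = begin
  conv (λ i → - f i) b n
    ≡⟨ conv-σ (λ i → - f i) b n ⟩
  σ (λ i → - f i * b (n ∸ i)) (suc n)
    ≡˘⟨ σ-cong (λ i → neg-distribˡ-* (f i) (b (n ∸ i))) (suc n) ⟩
  σ (λ i → - (f i * b (n ∸ i))) (suc n)
    ≡⟨ σ-neg (λ i → f i * b (n ∸ i)) (suc n) ⟩
  - σ (λ i → f i * b (n ∸ i)) (suc n)
    ≡˘⟨ cong -_ (conv-σ f b n) ⟩
  - conv f b n ∎
  where open ≡-Reasoning

-- b 0 ≡ 0 makes the truncated index n ∸ m harmless when m > n.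
conv-at : ∀ (b : ℕ → ℤ) → b 0 ≡ + 0 → ∀ m c n → conv (at m c) b n ≡ c * b (n ∸ m)
conv-at b b0 m c n with m ℕₚ.≤? n
... | yes m≤n = trans (conv-σ (at m c) b n) (σ-at-< (suc n) m c (λ i → b (n ∸ i)) (s≤s m≤n))
... | no  m≰n = begin
  conv (at m c) b n                    ≡⟨ conv-σ (at m c) b n ⟩
  σ (λ i → at m c i * b (n ∸ i)) (suc n) ≡⟨ σ-at-≥ (suc n) m c (λ i → b (n ∸ i)) (ℕₚ.≰⇒> m≰n) ⟩
  + 0                                  ≡˘⟨ *-zeroʳ c ⟩
  c * + 0                              ≡˘⟨ cong (c *_) b0 ⟩
  c * b 0                              ≡˘⟨ cong (λ t → c * b t) (ℕₚ.m≤n⇒m∸n≡0 (ℕₚ.<⇒≤ (ℕₚ.≰⇒> m≰n))) ⟩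
  c * b (n ∸ m)                        ∎
  where open ≡-Reasoning

conv-denominator : ∀ (b : ℕ → ℤ) → b 0 ≡ + 0 → ∀ A B C r n →
  conv (λ i → at 0 (+ 1) i - at 1 A i + at 2 B i + at r C i) b n
    ≡ b n - A * b (n ∸ 1) + B * b (n ∸ 2) + C * b (n ∸ r)
conv-denominator b b0 A B C r n =
  trans (conv-+ (λ i → at 0 (+ 1) i - at 1 A i + at 2 B i) (at r C) b n) (cong₂ _+_
    (trans (conv-+ (λ i → at 0 (+ 1) i - at 1 A i) (at 2 B) b n) (cong₂ _+_
      (trans (conv-+ (at 0 (+ 1)) (λ i → - at 1 A i) b n) (cong₂ _+_
        (trans (conv-at b b0 0 (+ 1) n) (*-identityˡ (b n)))
        (trans (conv-neg (at 1 A) b n) (cong -_ (conv-at b b0 1 A n)))))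
      (conv-at b b0 2 B n)))
    (conv-at b b0 r C n))

at-scale : ∀ m c n → at m c n ≡ c * at m (+ 1) n
at-scale m c n with n ℕ.≡ᵇ m
... | true  = sym (*-identityʳ c)
... | false = sym (*-zeroʳ c)

at-∸ : ∀ m d n c → at (suc m) c (n ∸ d) ≡ at (d ℕ.+ suc m) c n
at-∸ m zero    n       c = refl
at-∸ m (suc d) zero    c = refl
at-∸ m (suc d) (suc n) c = at-∸ m d n c

at-< : ∀ {n m} c → n < m → at m c n ≡ + 0
at-< {zero}  {suc m} c _         = refl
at-< {suc n} {suc m} c (s≤s n<m) = at-< c n<m

at-+ : ∀ m c r → at m c (m ℕ.+ r) ≡ at 0 c r
at-+ zero    c r = refl
at-+ (suc m) c r = at-+ m c r

transfer-identity : ∀ (a u v z e U g₀ g₁ g₂ g₃ Z₀ O₀ Z₁ O₁ T₁ Z₃ δ₁ δ₂ δ₃ δ₄ : ℤ) →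
  g₀ ≡ Z₀ + O₀ →
  Z₀ ≡ a * g₁ + z * δ₁ →
  O₀ ≡ v * Z₁ + u * (O₁ - T₁) + e * δ₁ →
  g₁ ≡ Z₁ + O₁ →
  Z₁ ≡ a * g₂ + z * δ₂ →
  T₁ ≡ U * e * δ₃ + U * v * Z₃ →
  Z₃ ≡ a * g₃ + z * δ₄ →
  g₀ - (a + u) * g₁ + a * (u - v) * g₂ + a * v * (u * U) * g₃
    ≡ (z + e) * δ₁ - (u - v) * z * δ₂ - u * U * e * δ₃ - u * U * v * z * δ₄
transfer-identity a u v z e U _ _ g₂ g₃ _ _ _ O₁ _ _ δ₁ δ₂ δ₃ δ₄ refl refl refl refl refl refl refl =
  solve (a ∷ u ∷ v ∷ z ∷ e ∷ U ∷ g₂ ∷ g₃ ∷ O₁ ∷ δ₁ ∷ δ₂ ∷ δ₃ ∷ δ₄ ∷ [])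

∸-∸-1 : ∀ n m → n ∸ m ∸ 1 ≡ n ∸ suc m
∸-∸-1 n m = trans (ℕₚ.∸-+-assoc n m 1) (cong (n ∸_) (ℕₚ.+-comm m 1))

-- Z, O and T stand for the totals over the words starting with 0, with 1, and with 1^(j+1).
module Transfer (a u v z e U : ℤ) (j : ℕ) (g Z O T : ℕ → ℤ)
  (g-split : ∀ n → g n ≡ Z n + O n)
  (Z-eq : ∀ n → Z n ≡ a * g (n ∸ 1) + at 1 z n)
  (O-eq : ∀ n → O n ≡ v * Z (n ∸ 1) + u * (O (n ∸ 1) - T (n ∸ 1)) + at 1 e n)
  (T-eq : ∀ n → T n ≡ at (suc j) (U * e) n + U * v * Z (n ∸ suc j))
  where

  recurrence : ∀ n →
    g n - (a + u) * g (n ∸ 1) + a * (u - v) * g (n ∸ 2) + a * v * (u * U) * g (n ∸ (3 ℕ.+ j))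
      ≡ (z + e) * at 1 (+ 1) n - (u - v) * z * at 2 (+ 1) n
        - u * U * e * at (2 ℕ.+ j) (+ 1) n - u * U * v * z * at (3 ℕ.+ j) (+ 1) n
  recurrence n = transfer-identity a u v z e U
    (g n) (g (n ∸ 1)) (g (n ∸ 2)) (g (n ∸ (3 ℕ.+ j)))
    (Z n) (O n) (Z (n ∸ 1)) (O (n ∸ 1)) (T (n ∸ 1)) (Z (n ∸ (2 ℕ.+ j)))
    (at 1 (+ 1) n) (at 2 (+ 1) n) (at (2 ℕ.+ j) (+ 1) n) (at (3 ℕ.+ j) (+ 1) n)
    (g-split n)
    (trans (Z-eq n) (cong (_+_ (a * g (n ∸ 1))) (at-scale 1 z n)))
    (trans (O-eq n) (cong (_+_ (v * Z (n ∸ 1) + u * (O (n ∸ 1) - T (n ∸ 1)))) (at-scale 1 e n)))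
    (g-split (n ∸ 1))
    (trans (Z-eq (n ∸ 1)) (cong₂ _+_
      (cong (λ i → a * g i) (∸-∸-1 n 1))
      (trans (at-∸ 0 1 n z) (at-scale 2 z n))))
    (trans (T-eq (n ∸ 1)) (cong₂ _+_
      (trans (at-∸ j 1 n (U * e)) (at-scale (2 ℕ.+ j) (U * e) n))
      (cong (λ i → U * v * Z i) (ℕₚ.∸-+-assoc n 1 (suc j)))))
    (trans (Z-eq (n ∸ (2 ℕ.+ j))) (cong₂ _+_
      (cong (λ i → a * g i) (∸-∸-1 n (2 ℕ.+ j)))
      (trans (at-∸ 0 (2 ℕ.+ j) n z)
        (trans (cong (λ i → at i z n) (ℕₚ.+-comm (2 ℕ.+ j) 1)) (at-scale (3 ℕ.+ j) z n)))))

^-distrib-* : ∀ (x y : ℤ) n → (x * y) ^ n ≡ x ^ n * y ^ n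
^-distrib-* x y zero    = refl
^-distrib-* x y (suc n) = trans (cong (_*_ (x * y)) (^-distrib-* x y n)) (*-interchange x y (x ^ n) (y ^ n))

pad-zeros : ∀ x y c → c ≡ x * + 0 + y * (+ 0 - + 0) + c
pad-zeros = solve-∀

if-scale : ∀ c b {x y : ℤ} → x ≡ c * y → (if b then + 0 else x) ≡ c * (if b then + 0 else y)
if-scale c true  _    = sym (*-zeroʳ c)
if-scale c false x≡cy = x≡cy

module Weights (p q : ℤ) where

  mono : ℕ → ℕ → ℤ
  mono m n = p ^ m * q ^ n

  mono-* : ∀ m n m′ n′ → mono m n * mono m′ n′ ≡ mono (m ℕ.+ m′) (n ℕ.+ n′)
  mono-* m n m′ n′ = trans (*-interchange (p ^ m) (q ^ n) (p ^ m′) (q ^ n′))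
    (sym (cong₂ _*_ (^-distribˡ-+-* p m m′) (^-distribˡ-+-* q n n′)))

  mono-^ : ∀ m n i → mono m n ^ i ≡ mono (m ℕ.* i) (n ℕ.* i)
  mono-^ m n i = trans (^-distrib-* (p ^ m) (q ^ n) i) (cong₂ _*_ (^-*-assoc p m i) (^-*-assoc q n i))

  weight : List Bool → ℤ
  weight w = mono (edg w) (ver w)

  weight-∷ : ∀ b w → weight (b ∷ w) ≡ mono (Δedg b w) (Δver b w) * weight w
  weight-∷ b w = trans (cong₂ mono (edg-∷ b w) (ver-∷ b w)) (sym (mono-* (Δedg b w) (Δver b w) (edg w) (ver w)))

module Avoiding (j : ℕ) (p q : ℤ) where
  open Weights p q

  k : ℕ
  k = suc (suc j)

  -- Prepending 0 to a nonempty word multiplies its weight by a, prepending 1 multiplies it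
  -- by v or u according as the word starts with 0 or 1; z and e are the weights of 0 and 1.
  a u v z e U : ℤ
  a = mono 3 2
  u = mono 5 3
  v = mono 6 4
  z = mono 4 4
  e = mono 7 6
  U = u ^ j

  avoidWeight : List Bool → ℤ
  avoidWeight w = if hasRun k w then + 0 else weight w

  avoidWeight-0∷ : ∀ c w → avoidWeight (false ∷ c ∷ w) ≡ a * avoidWeight (c ∷ w)
  avoidWeight-0∷ c w = if-scale a (hasRun k (c ∷ w)) (weight-∷ false (c ∷ w))

  avoidWeight-10∷ : ∀ w → avoidWeight (true ∷ false ∷ w) ≡ v * avoidWeight (false ∷ w)
  avoidWeight-10∷ w = if-scale v (hasRun k w) (weight-∷ true (false ∷ w))

  avoidWeight-11∷ : ∀ w → avoidWeight (true ∷ true ∷ w)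
    ≡ u * (avoidWeight (true ∷ w) - (if startsWithOnes j w then avoidWeight (true ∷ w) else + 0))
  avoidWeight-11∷ w with startsWithOnes j w
  ... | true  = sym (trans (cong (u *_) (+-inverseʳ (avoidWeight (true ∷ w)))) (*-zeroʳ u))
  ... | false = trans (if-scale u (hasRun k (true ∷ w)) (weight-∷ true (true ∷ w)))
                      (cong (u *_) (sym (+-identityʳ (avoidWeight (true ∷ w)))))

  weight-run : ∀ i x → weight (replicate (suc i) true ++ x) ≡ u ^ i * weight (true ∷ x)
  weight-run zero    x = sym (*-identityˡ _)
  weight-run (suc i) x = trans (weight-∷ true (replicate (suc i) true ++ x))
    (trans (cong (u *_) (weight-run i x)) (sym (*-assoc u (u ^ i) _)))

  avoidWeight-run : avoidWeight (replicate (suc j) true ++ []) ≡ U * e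
  avoidWeight-run =
    trans (cong (λ b → if b then + 0 else weight (replicate (suc j) true ++ []))
                (hasRun-replicate-++ (suc j) (suc j) [] ℕₚ.≤-refl λ _ → refl))
          (weight-run j [])

  avoidWeight-run-0∷ : ∀ w → avoidWeight (replicate (suc j) true ++ false ∷ w) ≡ U * v * avoidWeight (false ∷ w)
  avoidWeight-run-0∷ w =
    trans (cong (λ b → if b then + 0 else weight (replicate (suc j) true ++ false ∷ w))
                (hasRun-replicate-++ (suc j) (suc j) (false ∷ w) ℕₚ.≤-refl λ _ → refl))
          (if-scale (U * v) (hasRun k w)
            (trans (weight-run j (false ∷ w))
              (trans (cong (U *_) (weight-∷ true (false ∷ w))) (sym (*-assoc U v _)))))

  avoidWeight-run-1∷ : ∀ w → avoidWeight (replicate (suc j) true ++ true ∷ w) ≡ + 0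
  avoidWeight-run-1∷ w =
    cong (λ b → if b then + 0 else weight (replicate (suc j) true ++ true ∷ w))
         (cong (_∨ hasRun k (replicate j true ++ true ∷ w)) (startsWithOnes-replicate-∷ (suc j) w))

  -- Indexed by the length of the whole word; startingWithRun sums over the words 1w with w
  -- beginning with 1^(k-2), i.e. the words beginning with 1^(k-1).
  startingWith : Bool → ℕ → ℤ
  startingWith b zero    = + 0
  startingWith b (suc m) = sumWords m (λ w → avoidWeight (b ∷ w))

  startingWithRun : ℕ → ℤ
  startingWithRun zero    = + 0
  startingWithRun (suc m) = sumWords m (λ w → if startsWithOnes j w then avoidWeight (true ∷ w) else + 0)

  g-sumWords : ∀ m → g k p q (suc m) ≡ sumWords (suc m) avoidWeight
  g-sumWords m = trans (sum-filter-avoiding k weight (words (suc m))) (sumWords-words (suc m) avoidWeight)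

  g-split : ∀ n → g k p q n ≡ startingWith false n + startingWith true n
  g-split zero    = refl
  g-split (suc m) = trans (g-sumWords m) (sumWords-+ m _ _)

  startingWith-false : ∀ n → startingWith false n ≡ a * g k p q (n ∸ 1) + at 1 z n
  startingWith-false zero          = sym (trans (+-identityʳ (a * + 0)) (*-zeroʳ a))
  startingWith-false (suc zero)    = sym (trans (cong (_+ z) (*-zeroʳ a)) (+-identityˡ z))
  startingWith-false (suc (suc m)) = begin
    sumWords m (λ w → avoidWeight (false ∷ false ∷ w) + avoidWeight (false ∷ true ∷ w))
      ≡⟨ sumWords-cong m (λ w → trans (cong₂ _+_ (avoidWeight-0∷ false w) (avoidWeight-0∷ true w))
                                      (sym (*-distribˡ-+ a _ _))) ⟩
    sumWords m (λ w → a * (avoidWeight (false ∷ w) + avoidWeight (true ∷ w)))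
      ≡⟨ sumWords-* m a _ ⟩
    a * sumWords (suc m) avoidWeight
      ≡˘⟨ cong (a *_) (g-sumWords m) ⟩
    a * g k p q (suc m)
      ≡˘⟨ +-identityʳ _ ⟩
    a * g k p q (suc m) + + 0 ∎
    where open ≡-Reasoning

  startingWith-true : ∀ n → startingWith true n
    ≡ v * startingWith false (n ∸ 1) + u * (startingWith true (n ∸ 1) - startingWithRun (n ∸ 1)) + at 1 e n
  startingWith-true zero          = pad-zeros v u (+ 0)
  startingWith-true (suc zero)    = pad-zeros v u e
  startingWith-true (suc (suc m)) = begin
    sumWords m (λ w → avoidWeight (true ∷ false ∷ w) + avoidWeight (true ∷ true ∷ w))
      ≡⟨ sumWords-cong m (λ w → cong₂ _+_ (avoidWeight-10∷ w) (avoidWeight-11∷ w)) ⟩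
    sumWords m (λ w → v * avoidWeight (false ∷ w) + u * (avoidWeight (true ∷ w) - R w))
      ≡⟨ sumWords-+ m _ _ ⟩
    sumWords m (λ w → v * avoidWeight (false ∷ w)) + sumWords m (λ w → u * (avoidWeight (true ∷ w) - R w))
      ≡⟨ cong₂ _+_ (sumWords-* m v _) (sumWords-* m u _) ⟩
    v * startingWith false (suc m) + u * sumWords m (λ w → avoidWeight (true ∷ w) - R w)
      ≡⟨ cong (λ t → v * startingWith false (suc m) + u * t)
              (trans (sumWords-+ m _ _) (cong (_+_ (startingWith true (suc m))) (sumWords-neg m R))) ⟩
    v * startingWith false (suc m) + u * (startingWith true (suc m) - startingWithRun (suc m))
      ≡˘⟨ +-identityʳ _ ⟩
    v * startingWith false (suc m) + u * (startingWith true (suc m) - startingWithRun (suc m)) + + 0 ∎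
    where
    open ≡-Reasoning
    R : List Bool → ℤ
    R w = if startsWithOnes j w then avoidWeight (true ∷ w) else + 0

  startingWithRun-short : ∀ n → n ≤ j → startingWithRun n ≡ + 0
  startingWithRun-short zero    _   = refl
  startingWithRun-short (suc m) m<j = sumWords-startsWithOnes-short m j _ m<j

  startingWithRun-long : ∀ r → startingWithRun (suc j ℕ.+ r) ≡ at 0 (U * e) r + U * v * startingWith false r
  startingWithRun-long r = trans (sumWords-startsWithOnes j r (λ w → avoidWeight (true ∷ w))) (after-run r)
    where
    after-run : ∀ r → sumWords r (λ w → avoidWeight (replicate (suc j) true ++ w))
      ≡ at 0 (U * e) r + U * v * startingWith false r
    after-run zero    = trans avoidWeight-run
      (sym (trans (cong (_+_ (U * e)) (*-zeroʳ (U * v))) (+-identityʳ (U * e))))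
    after-run (suc r) = begin
      sumWords r (λ w → avoidWeight (replicate (suc j) true ++ false ∷ w)
                        + avoidWeight (replicate (suc j) true ++ true ∷ w))
        ≡⟨ sumWords-cong r (λ w → trans (cong₂ _+_ (avoidWeight-run-0∷ w) (avoidWeight-run-1∷ w))
                                        (+-identityʳ _)) ⟩
      sumWords r (λ w → U * v * avoidWeight (false ∷ w))
        ≡⟨ sumWords-* r (U * v) _ ⟩
      U * v * startingWith false (suc r)
        ≡˘⟨ +-identityˡ _ ⟩
      + 0 + U * v * startingWith false (suc r) ∎
      where open ≡-Reasoning

  startingWithRun-eq : ∀ n → startingWithRun n ≡ at (suc j) (U * e) n + U * v * startingWith false (n ∸ suc j)
  startingWithRun-eq n with n ℕₚ.≤? j
  ... | yes n≤j = begin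
    startingWithRun n                                  ≡⟨ startingWithRun-short n n≤j ⟩
    + 0                                                ≡˘⟨ *-zeroʳ (U * v) ⟩
    U * v * startingWith false 0                       ≡˘⟨ cong (λ i → U * v * startingWith false i)
                                                                (ℕₚ.m≤n⇒m∸n≡0 (ℕₚ.m≤n⇒m≤1+n n≤j)) ⟩
    U * v * startingWith false (n ∸ suc j)             ≡˘⟨ +-identityˡ _ ⟩
    + 0 + U * v * startingWith false (n ∸ suc j)       ≡˘⟨ cong (_+ U * v * startingWith false (n ∸ suc j))
                                                                (at-< (U * e) (s≤s n≤j)) ⟩
    at (suc j) (U * e) n + U * v * startingWith false (n ∸ suc j) ∎
    where open ≡-Reasoning
  ... | no n≰j with ℕₚ.m≤n⇒∃[o]m+o≡n (ℕₚ.≰⇒> n≰j)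
  ...   | r , refl = trans (startingWithRun-long r) (cong₂ _+_
            (sym (at-+ (suc j) (U * e) r))
            (cong (λ i → U * v * startingWith false i) (sym (ℕₚ.m+n∸m≡n (suc j) r))))

  U-split : mono (5 ℕ.* k) (3 ℕ.* k) ≡ U * mono 10 6
  U-split = begin
    mono (5 ℕ.* k) (3 ℕ.* k)              ≡⟨ cong₂ mono (ℕₚ.*-distribˡ-+ 5 2 j) (ℕₚ.*-distribˡ-+ 3 2 j) ⟩
    mono (10 ℕ.+ 5 ℕ.* j) (6 ℕ.+ 3 ℕ.* j) ≡˘⟨ mono-* 10 6 (5 ℕ.* j) (3 ℕ.* j) ⟩
    mono 10 6 * mono (5 ℕ.* j) (3 ℕ.* j)  ≡⟨ *-comm (mono 10 6) _ ⟩
    mono (5 ℕ.* j) (3 ℕ.* j) * mono 10 6  ≡˘⟨ cong (_* mono 10 6) (mono-^ 5 3 j) ⟩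
    U * mono 10 6                          ∎
    where open ≡-Reasoning

  mono-k : ∀ d d′ → mono (5 ℕ.* k ℕ.+ d) (3 ℕ.* k ℕ.+ d′) ≡ U * mono (10 ℕ.+ d) (6 ℕ.+ d′)
  mono-k d d′ = trans (sym (mono-* (5 ℕ.* k) (3 ℕ.* k) d d′))
    (trans (cong (_* mono d d′) U-split) (trans (*-assoc U _ _) (cong (U *_) (mono-* 10 6 d d′))))

  mono-*-U : ∀ m n r s → mono m n * (U * mono r s) ≡ U * mono (m ℕ.+ r) (n ℕ.+ s)
  mono-*-U m n r s = trans (*-left-comm (mono m n) U _) (cong (U *_) (mono-* m n r s))

  B-factor : mono 8 5 - mono 9 6 ≡ a * (u - v)
  B-factor = sym (trans (x[y-z]≈xy-xz a u v) (cong₂ _-_ (mono-* 3 2 5 3) (mono-* 3 2 6 4)))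

  C-factor : mono (5 ℕ.* k ℕ.+ 4) (3 ℕ.* k ℕ.+ 3) ≡ a * v * (u * U)
  C-factor = trans (mono-k 4 3) (sym (trans (regroup a v u U)
    (cong (U *_) (trans (cong (_* u) (mono-* 3 2 6 4)) (mono-* 9 6 5 3)))))
    where
    regroup : ∀ a v u U → a * v * (u * U) ≡ U * (a * v * u)
    regroup = solve-∀

  numer-expansion : ∀ n → numer k p q n
    ≡ (z + e) * at 1 (+ 1) n - (u - v) * z * at 2 (+ 1) n
      - u * U * e * at k (+ 1) n - u * U * v * z * at (suc k) (+ 1) n
  numer-expansion n = begin
    P * (at 1 X n - at 2 Y n - at k W n - at (suc k) W′ n)
      ≡⟨ cong (P *_) (cong₂ _-_ (cong₂ _-_ (cong₂ _-_ (at-scale 1 X n) (at-scale 2 Y n))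
                                            (at-scale k W n)) (at-scale (suc k) W′ n)) ⟩
    P * (X * δ₁ - Y * δ₂ - W * δ₃ - W′ * δ₄)
      ≡⟨ expand P X Y W W′ δ₁ δ₂ δ₃ δ₄ ⟩
    P * X * δ₁ - P * Y * δ₂ - P * W * δ₃ - P * W′ * δ₄
      ≡⟨ cong₂ _-_ (cong₂ _-_ (cong₂ _-_ (cong (_* δ₁) PX) (cong (_* δ₂) PY))
                              (cong (_* δ₃) PW)) (cong (_* δ₄) PW′) ⟩
    (z + e) * δ₁ - (u - v) * z * δ₂ - u * U * e * δ₃ - u * U * v * z * δ₄ ∎
    where
    open ≡-Reasoning
    P X Y W W′ δ₁ δ₂ δ₃ δ₄ : ℤ
    P  = mono 2 3
    X  = p ^ 2 * q + mono 5 3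
    Y  = mono 7 4 - mono 8 5
    W  = mono (5 ℕ.* k) (3 ℕ.* k)
    W′ = mono (5 ℕ.* k ℕ.+ 3) (3 ℕ.* k ℕ.+ 2)
    δ₁ = at 1 (+ 1) n
    δ₂ = at 2 (+ 1) n
    δ₃ = at k (+ 1) n
    δ₄ = at (suc k) (+ 1) n
    expand : ∀ P X Y W W′ d₁ d₂ d₃ d₄ →
      P * (X * d₁ - Y * d₂ - W * d₃ - W′ * d₄) ≡ P * X * d₁ - P * Y * d₂ - P * W * d₃ - P * W′ * d₄
    expand = solve-∀
    PX : P * X ≡ z + e
    PX = trans (*-distribˡ-+ P _ _)
      (cong₂ _+_ (trans (cong (λ t → P * (p ^ 2 * t)) (sym (*-identityʳ q))) (mono-* 2 3 2 1))
                 (mono-* 2 3 5 3))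
    PY : P * Y ≡ (u - v) * z
    PY = trans (x[y-z]≈xy-xz P _ _) (trans (cong₂ _-_ (mono-* 2 3 7 4) (mono-* 2 3 8 5))
      (sym (trans ([y-z]x≈yx-zx z u v) (cong₂ _-_ (mono-* 5 3 4 4) (mono-* 6 4 4 4)))))
    PW : P * W ≡ u * U * e
    PW = trans (cong (P *_) U-split) (trans (mono-*-U 2 3 10 6)
      (sym (trans (*-assoc-comm u U e) (cong (U *_) (mono-* 5 3 7 6)))))
    PW′ : P * W′ ≡ u * U * v * z
    PW′ = trans (cong (P *_) (mono-k 3 2)) (trans (mono-*-U 2 3 13 8)
      (sym (trans (regroup u U v z) (cong (U *_) (trans (cong (_* z) (mono-* 5 3 6 4)) (mono-* 11 7 4 4))))))
      where
      regroup : ∀ u U v z → u * U * v * z ≡ U * (u * v * z)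
      regroup = solve-∀

  open Transfer a u v z e U j (g k p q) (startingWith false) (startingWith true) startingWithRun
    g-split startingWith-false startingWith-true startingWithRun-eq

  conv-denom≡numer : ∀ n → conv (denom k p q) (g k p q) n ≡ numer k p q n
  conv-denom≡numer n = begin
    conv (denom k p q) G n
      ≡⟨ conv-denominator G refl (a + u) (mono 8 5 - mono 9 6) C (suc k) n ⟩
    G n - (a + u) * G (n ∸ 1) + (mono 8 5 - mono 9 6) * G (n ∸ 2) + C * G (n ∸ suc k)
      ≡⟨ cong₂ (λ B′ C′ → G n - (a + u) * G (n ∸ 1) + B′ * G (n ∸ 2) + C′ * G (n ∸ suc k))
               B-factor C-factor ⟩
    G n - (a + u) * G (n ∸ 1) + a * (u - v) * G (n ∸ 2) + a * v * (u * U) * G (n ∸ suc k)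
      ≡⟨ recurrence n ⟩
    (z + e) * at 1 (+ 1) n - (u - v) * z * at 2 (+ 1) n
      - u * U * e * at k (+ 1) n - u * U * v * z * at (suc k) (+ 1) n
      ≡˘⟨ numer-expansion n ⟩
    numer k p q n ∎
    where
    open ≡-Reasoning
    G : ℕ → ℤ
    G = g k p q
    C : ℤ
    C = mono (5 ℕ.* k ℕ.+ 4) (3 ℕ.* k ℕ.+ 3)

theorem2p1 : (k : ℕ) → 2 ≤ k → (p q : ℤ) → (n : ℕ) →
    conv (denom k p q) (g k p q) n ≡ numer k p q n
theorem2p1 .(suc (suc j)) (s≤s (s≤s {n = j} z≤n)) p q = Avoiding.conv-denom≡numer j p q
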